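{- Let $F$ and $g$ be positive integers such that $g \leq F \leq 2g-1$. The correspondence $\theta: \mathcal{S}(F,g) \to \mathcal{E}(F,g)$ defined by $$\theta(S) = \left(S \setminus \{x \in S\setminus\{0\} : x < \tfrac{F}{2}\}\right) \cup \{F - x : x \in S\setminus\{0\},\ x < \tfrac{F}{2}\}$$ is a well-defined surjective map. Moreover, for $S \in \mathcal{S}(F,g)$, $\theta(S) = S$ if and only if $S \in \mathcal{E}(F,g)$.
   Context: A numerical semigroup is a subset $S \subseteq \mathbb{N}$ (with $\mathbb{N}$ the nonnegative integers) closed under addition, containing $0$, with $\mathbb{N}\setminus S$ finite. The genus of $S$ is $\#(\mathbb{N}\setminus S)$; the Frobenius number $\mathrm{F}(S)$ is the largest integer not in $S$; the multiplicity $\mathrm{m}(S)$ is the least positive integer in $S$. $S$ is called elementary if $\mathrm{F}(S) < 2\,\mathrm{m}(S)$. $\mathcal{S}(F,g)$ denotes the set of numerical semigroups with Frobenius number $F$ and genus $g$, and $\mathcal{E}(F,g)$ the set of elementary numerical semigroups with Frobenius number $F$ and genus $g$. -}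

module Defs where

open import Data.Bool using (Bool; true; false; _∧_; _∨_; not; if_then_else_)
open import Data.Nat using (ℕ; zero; suc; _+_; _*_; _∸_; _≤_; _<_; _≡ᵇ_; _<ᵇ_)
open import Data.Product using (Σ; ∃; _×_; _,_)
open import Relation.Binary.PropositionalEquality using (_≡_)

-- A subset of ℕ, given by its (decidable) membership function.
-- (Numerical semigroups have finite complement, so membership is decidable.)
Subsetℕ : Set
Subsetℕ = ℕ → Bool

_∈ₛ_ : ℕ → Subsetℕ → Set
n ∈ₛ S = S n ≡ true

_∉ₛ_ : ℕ → Subsetℕ → Set
n ∉ₛ S = S n ≡ false

record IsNumericalSemigroup (S : Subsetℕ) : Set where
  field
    zero∈   : 0 ∈ₛ S
    closed  : ∀ a b → a ∈ₛ S → b ∈ₛ S → (a + b) ∈ₛ S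
    cofinite : ∃ λ b → ∀ n → b ≤ n → n ∈ₛ S

gapsBelow : Subsetℕ → ℕ → ℕ
gapsBelow S zero = zero
gapsBelow S (suc n) = gapsBelow S n + (if S n then 0 else 1)

-- genus: #(ℕ ∖ S) = g, counted below any bound beyond which S contains everything
HasGenus : Subsetℕ → ℕ → Set
HasGenus S g = ∃ λ b → (∀ n → b ≤ n → n ∈ₛ S) × gapsBelow S b ≡ g

IsFrobenius : Subsetℕ → ℕ → Set
IsFrobenius S F = F ∉ₛ S × (∀ n → F < n → n ∈ₛ S)

IsMultiplicity : Subsetℕ → ℕ → Set
IsMultiplicity S m = 0 < m × m ∈ₛ S × (∀ k → 0 < k → k < m → k ∉ₛ S)

IsElementary : Subsetℕ → Set
IsElementary S = ∃ λ F → IsFrobenius S F × ∃ λ m → IsMultiplicity S m × F < 2 * m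

InS : ℕ → ℕ → Subsetℕ → Set
InS F g S = IsNumericalSemigroup S × IsFrobenius S F × HasGenus S g

InE : ℕ → ℕ → Subsetℕ → Set
InE F g S = InS F g S × IsElementary S

-- "x ∈ S∖{0} and x < F/2"  (x < F/2 ⇔ 2x < F)
small : ℕ → Subsetℕ → ℕ → Bool
small F S x = S x ∧ not (x ≡ᵇ 0) ∧ (2 * x <ᵇ F)

-- does y = F - x for some x with small F S x ?  (such x satisfy x < F)
anyReflected : ℕ → Subsetℕ → ℕ → ℕ → Bool
anyReflected F S y zero = false
anyReflected F S y (suc k) = (small F S k ∧ ((F ∸ k) ≡ᵇ y)) ∨ anyReflected F S y k

θ : ℕ → Subsetℕ → Subsetℕ
θ F S y = (S y ∧ not (small F S y)) ∨ anyReflected F S y F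

_≐_ : Subsetℕ → Subsetℕ → Set
S ≐ T = ∀ n → S n ≡ T n

-- For x ∈ S \ {0} with 2x < F, the element F − x cannot lie in S (else F = x + (F − x) ∈ S), so θ
-- moves each such small element to the gap F − x. Every pair {i, F − i} then keeps its number of
-- gaps (a semigroup never contains both members), hence θ preserves the genus. Every positive
-- element y of θ(S) satisfies 2y > F: either y was kept and 2y ≠ F because F ∉ S, or y = F − x with
-- 2x < F. This makes θ(S) closed under addition and elementary. Conversely an elementary semigroup
-- has no small elements at all, so θ fixes it, which also gives surjectivity.
module Submission where

open import Defs
import Data.Bool as Bool
open import Data.Bool using (Bool; true; false; _∧_; _∨_; not; if_then_else_)
open import Data.Bool.Properties
  using (not-injective; not-¬; ¬-not; ⇔→≡; ∧-conicalˡ; ∧-conicalʳ; ∧-identityʳ; ∨-identityʳ; ∨-zeroʳ; T-≡)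
open import Data.Nat using (ℕ; zero; suc; _+_; _*_; _∸_; _≤_; _<_; z<s; _≡ᵇ_; _<ᵇ_; _<?_; _≤?_)
open import Data.Nat.Properties
open import Algebra.Properties.CommutativeSemigroup +-commutativeSemigroup using (interchange)
open import Data.Product using (_×_; ∃; _,_; proj₁; proj₂)
open import Data.Sum using (_⊎_; inj₁; inj₂)
open import Data.Empty using (⊥; ⊥-elim)
open import Function using (_∘_; case_of_)
open import Function.Bundles using (_⇔_; mk⇔; Equivalence)
open import Relation.Nullary using (¬_; Dec; yes; no; contradiction)
open import Relation.Nullary.Decidable using (_×-dec_)
open import Relation.Binary.Definitions using (tri<; tri≈; tri>)
open import Relation.Binary.PropositionalEquality

private variable
  F g x y : ℕ
  S T : Subsetℕ

∨-true⁻ : ∀ a {b} → a ∨ b ≡ true → a ≡ true ⊎ b ≡ true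
∨-true⁻ true  _ = inj₁ refl
∨-true⁻ false e = inj₂ e

∨-trueʳ : ∀ a {b} → b ≡ true → a ∨ b ≡ true
∨-trueʳ a refl = ∨-zeroʳ a

2*n≡n+n : ∀ n → 2 * n ≡ n + n
2*n≡n+n n = cong (n +_) (+-identityʳ n)

reflection-small⇒large : 2 * (F ∸ x) < F → F < 2 * x
reflection-small⇒large {F} {x} small with x ≤? F
... | no x≰F = <-≤-trans (≰⇒> x≰F) (m≤m+n x (x + 0))
... | yes x≤F = +-cancelˡ-< F F (2 * x) (begin-strict
  F + F                 ≡⟨ 2*n≡n+n F ⟨
  2 * F                 ≡⟨ cong (2 *_) (m∸n+n≡m x≤F) ⟨
  2 * ((F ∸ x) + x)     ≡⟨ *-distribˡ-+ 2 (F ∸ x) x ⟩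
  2 * (F ∸ x) + 2 * x   <⟨ +-monoˡ-< (2 * x) small ⟩
  F + 2 * x             ∎)
  where open ≤-Reasoning

large+large : F < 2 * x → F < 2 * y → F < x + y
large+large {F} {x} {y} Fx Fy with ≤-total x y
... | inj₁ x≤y = <-≤-trans (subst (F <_) (2*n≡n+n x) Fx) (+-monoʳ-≤ x x≤y)
... | inj₂ y≤x = <-≤-trans (subst (F <_) (2*n≡n+n y) Fy)
                   (subst (y + y ≤_) (+-comm y x) (+-monoʳ-≤ y y≤x))

minimal-witness : {P : ℕ → Set} → (∀ n → Dec (P n)) → ∀ {n} → P n →
  ∃ λ m → P m × (∀ k → k < m → ¬ P k)
minimal-witness {P} P? {n} Pn = search (suc n) n ≤-refl Pn
  where
  search : ∀ bound n → n < bound → P n → ∃ λ m → P m × (∀ k → k < m → ¬ P k)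
  search (suc bound) n n<bound Pn with anyUpTo? P? n
  ... | yes (k , k<n , Pk) = search bound k (<-≤-trans k<n (m<1+n⇒m≤n n<bound)) Pk
  ... | no none            = n , Pn , λ k k<n Pk → none (k , k<n , Pk)

sumBelow : (ℕ → ℕ) → ℕ → ℕ
sumBelow f zero    = 0
sumBelow f (suc n) = sumBelow f n + f n

sumBelow-cong : ∀ {f h} n → (∀ i → i < n → f i ≡ h i) → sumBelow f n ≡ sumBelow h n
sumBelow-cong zero    _   = refl
sumBelow-cong (suc n) f≗h =
  cong₂ _+_ (sumBelow-cong n (λ i i<n → f≗h i (m<n⇒m<1+n i<n))) (f≗h n ≤-refl)

sumBelow-+ : ∀ f h n → sumBelow (λ i → f i + h i) n ≡ sumBelow f n + sumBelow h n
sumBelow-+ f h zero    = refl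
sumBelow-+ f h (suc n) =
  trans (cong (_+ (f n + h n)) (sumBelow-+ f h n)) (interchange (sumBelow f n) (sumBelow h n) (f n) (h n))

sumBelow-suc : ∀ f n → sumBelow f (suc n) ≡ f 0 + sumBelow (λ i → f (suc i)) n
sumBelow-suc f zero    = +-comm 0 (f 0)
sumBelow-suc f (suc n) = trans (cong (_+ f (suc n)) (sumBelow-suc f n)) (+-assoc (f 0) _ _)

sumBelow-reverse : ∀ n f → sumBelow (λ i → f (n ∸ i)) (suc n) ≡ sumBelow f (suc n)
sumBelow-reverse zero    f = refl
sumBelow-reverse (suc n) f = begin
  sumBelow (λ i → f (suc n ∸ i)) (suc n) + f (suc n ∸ suc n)
    ≡⟨ cong₂ _+_ (sumBelow-cong (suc n) λ i i<1+n → cong f (+-∸-assoc 1 (m<1+n⇒m≤n i<1+n)))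
                 (cong f (n∸n≡0 n)) ⟩
  sumBelow (λ i → f (suc (n ∸ i))) (suc n) + f 0
    ≡⟨ cong (_+ f 0) (sumBelow-reverse n (λ j → f (suc j))) ⟩
  sumBelow (λ j → f (suc j)) (suc n) + f 0
    ≡⟨ +-comm _ (f 0) ⟩
  f 0 + sumBelow (λ j → f (suc j)) (suc n)
    ≡⟨ sumBelow-suc f (suc n) ⟨
  sumBelow f (suc (suc n)) ∎
  where open ≡-Reasoning

sumBelow-reflection-invariant : ∀ n {f h} →
  (∀ i → i < suc n → f i + f (n ∸ i) ≡ h i + h (n ∸ i)) → sumBelow f (suc n) ≡ sumBelow h (suc n)
sumBelow-reflection-invariant n {f} {h} pairs = *-cancelˡ-≡ _ _ 2 (begin
  2 * sumBelow f (suc n)                          ≡⟨ twice f ⟩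
  sumBelow (λ i → f i + f (n ∸ i)) (suc n)        ≡⟨ sumBelow-cong (suc n) pairs ⟩
  sumBelow (λ i → h i + h (n ∸ i)) (suc n)        ≡⟨ twice h ⟨
  2 * sumBelow h (suc n)                          ∎)
  where
  open ≡-Reasoning
  twice : ∀ f → 2 * sumBelow f (suc n) ≡ sumBelow (λ i → f i + f (n ∸ i)) (suc n)
  twice f = begin
    2 * sumBelow f (suc n)
      ≡⟨ 2*n≡n+n (sumBelow f (suc n)) ⟩
    sumBelow f (suc n) + sumBelow f (suc n)
      ≡⟨ cong (sumBelow f (suc n) +_) (sumBelow-reverse n f) ⟨
    sumBelow f (suc n) + sumBelow (λ i → f (n ∸ i)) (suc n)
      ≡⟨ sumBelow-+ f _ (suc n) ⟨
    sumBelow (λ i → f i + f (n ∸ i)) (suc n) ∎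

gap : Bool → ℕ
gap b = if b then 0 else 1

gapsBelow≡sumBelow : ∀ S n → gapsBelow S n ≡ sumBelow (λ i → gap (S i)) n
gapsBelow≡sumBelow S zero    = refl
gapsBelow≡sumBelow S (suc n) = cong (_+ gap (S n)) (gapsBelow≡sumBelow S n)

gapsBelow-stable : ∀ {c} → (∀ n → c ≤ n → n ∈ₛ S) → ∀ k → gapsBelow S (k + c) ≡ gapsBelow S c
gapsBelow-stable         S⊇ zero    = refl
gapsBelow-stable {S} {c} S⊇ (suc k) =
  trans (cong₂ _+_ (gapsBelow-stable S⊇ k) (cong gap (S⊇ (k + c) (m≤n+m c k)))) (+-identityʳ _)

-- Here a marks i ∈ S, b marks F − i ∈ S, p and q mark i and F − i as small.
gap-reflect-pair : ∀ a b p q →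
  (p ≡ true → a ≡ true) → (q ≡ true → b ≡ true) → (a ≡ true → b ≡ true → ⊥) →
  gap ((a ∧ not p) ∨ q) + gap ((b ∧ not q) ∨ p) ≡ gap a + gap b
gap-reflect-pair true  true  _     _     _   _   ¬ab = ⊥-elim (¬ab refl refl)
gap-reflect-pair false _     true  _     p⇒a _   _   = contradiction (p⇒a refl) λ ()
gap-reflect-pair _     false _     true  _   q⇒b _   = contradiction (q⇒b refl) λ ()
gap-reflect-pair false false false false _   _   _   = refl
gap-reflect-pair false true  false false _   _   _   = refl
gap-reflect-pair false true  false true  _   _   _   = refl
gap-reflect-pair true  false false false _   _   _   = refl
gap-reflect-pair true  false true  false _   _   _   = refl

Frobenius-unique : ∀ {F′} → IsFrobenius S F → IsFrobenius S F′ → F ≡ F′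
Frobenius-unique {S} {F} {F′} (F∉S , S>F) (F′∉S , S>F′) with <-cmp F F′
... | tri< F<F′ _ _ = ⊥-elim (not-¬ (S>F F′ F<F′) F′∉S)
... | tri≈ _ F≡F′ _ = F≡F′
... | tri> _ _ F′<F = ⊥-elim (not-¬ (S>F′ F F′<F) F∉S)

Frobenius-split-⊥ : IsNumericalSemigroup S → IsFrobenius S F →
  x ≤ F → x ∈ₛ S → (F ∸ x) ∈ₛ S → ⊥
Frobenius-split-⊥ {S} {F} {x} ns (F∉S , _) x≤F x∈S F-x∈S =
  not-¬ (subst (_∈ₛ S) (m+[n∸m]≡n x≤F) (closed x (F ∸ x) x∈S F-x∈S)) F∉S
  where open IsNumericalSemigroup ns

IsElementary-resp-≐ : S ≐ T → IsElementary S → IsElementary T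
IsElementary-resp-≐ S≐T (F , (F∉S , S>F) , m , (0<m , m∈S , S<m) , F<2m) =
  F , (trans (sym (S≐T F)) F∉S , λ n F<n → trans (sym (S≐T n)) (S>F n F<n)) ,
  m , (0<m , trans (sym (S≐T m)) m∈S , λ k 0<k k<m → trans (sym (S≐T k)) (S<m k 0<k k<m)) , F<2m

genus-gapsBelow-Frobenius : IsFrobenius S F → HasGenus S g → gapsBelow S (suc F) ≡ g
genus-gapsBelow-Frobenius {S} {F} {g} (_ , S>F) (b , S⊇ , gaps≡g) = begin
  gapsBelow S (suc F)       ≡⟨ gapsBelow-stable S>F b ⟨
  gapsBelow S (b + suc F)   ≡⟨ cong (gapsBelow S) (+-comm b (suc F)) ⟩
  gapsBelow S (suc F + b)   ≡⟨ gapsBelow-stable S⊇ (suc F) ⟩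
  gapsBelow S b             ≡⟨ gaps≡g ⟩
  g                         ∎
  where open ≡-Reasoning

small⁻ : ∀ S x → small F S x ≡ true → x ∈ₛ S × 0 < x × 2 * x < F
small⁻ {F} S x e =
  ∧-conicalˡ (S x) _ e , positive x (∧-conicalˡ _ _ rest) ,
  <ᵇ⇒< (2 * x) F (Equivalence.from T-≡ (∧-conicalʳ _ _ rest))
  where
  rest : not (x ≡ᵇ 0) ∧ (2 * x <ᵇ F) ≡ true
  rest = ∧-conicalʳ (S x) _ e
  positive : ∀ x → not (x ≡ᵇ 0) ≡ true → 0 < x
  positive (suc _) _ = z<s

small⁺ : ∀ S x → x ∈ₛ S → 0 < x → 2 * x < F → small F S x ≡ true
small⁺ {F} S (suc x) x∈S _ 2x<F rewrite x∈S = Equivalence.to (T-≡ {2 * suc x <ᵇ F}) (<⇒<ᵇ 2x<F)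

small-zero : ∀ F S → small F S 0 ≡ false
small-zero F S = ¬-not λ e → <-irrefl refl (proj₁ (proj₂ (small⁻ {F} S 0 e)))

small-large : ∀ S x → F ≤ 2 * x → small F S x ≡ false
small-large {F} S x F≤2x = ¬-not λ e → <⇒≱ (proj₂ (proj₂ (small⁻ {F} S x e))) F≤2x

small⇒< : ∀ S x → small F S x ≡ true → x < F
small⇒< {F} S x e =
  ≤-<-trans (m≤m+n x x) (subst (_< F) (2*n≡n+n x) (proj₂ (proj₂ (small⁻ S x e))))

anyReflected⁻ : ∀ n → anyReflected F S y n ≡ true → ∃ λ k → small F S k ≡ true × F ∸ k ≡ y
anyReflected⁻ {F} {S} {y} (suc n) e with ∨-true⁻ (small F S n ∧ ((F ∸ n) ≡ᵇ y)) e
... | inj₁ here  =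
  n , ∧-conicalˡ _ _ here , ≡ᵇ⇒≡ (F ∸ n) y (Equivalence.from T-≡ (∧-conicalʳ _ _ here))
... | inj₂ there = anyReflected⁻ n there

anyReflected⁺ : ∀ {k} n → small F S k ≡ true → F ∸ k ≡ y → k < n → anyReflected F S y n ≡ true
anyReflected⁺ {F} {S} {y} {k} (suc n) small-k F-k≡y k<1+n with m<1+n⇒m<n∨m≡n k<1+n
... | inj₁ k<n  = ∨-trueʳ (small F S n ∧ ((F ∸ n) ≡ᵇ y)) (anyReflected⁺ n small-k F-k≡y k<n)
... | inj₂ refl = cong (_∨ anyReflected F S y k)
  (cong₂ _∧_ small-k (Equivalence.to (T-≡ {(F ∸ k) ≡ᵇ y}) (≡⇒≡ᵇ (F ∸ k) y F-k≡y)))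

θ-apply : ∀ F S y → θ F S y ≡ (S y ∧ not (small F S y)) ∨ small F S (F ∸ y)
θ-apply F S y =
  cong ((S y ∧ not (small F S y)) ∨_) (⇔→≡ {z = true} (mk⇔ reflected⇒small small⇒reflected))
  where
  reflected⇒small : anyReflected F S y F ≡ true → small F S (F ∸ y) ≡ true
  reflected⇒small e with anyReflected⁻ F e
  ... | k , small-k , refl =
    subst (λ z → small F S z ≡ true) (sym (m∸[m∸n]≡n (<⇒≤ (small⇒< S k small-k)))) small-k
  small⇒reflected : small F S (F ∸ y) ≡ true → anyReflected F S y F ≡ true
  small⇒reflected e with y ≤? F
  ... | yes y≤F = anyReflected⁺ F e (m∸[m∸n]≡n y≤F) (small⇒< S (F ∸ y) e)
  ... | no  y≰F =
    contradiction (m≤n⇒m∸n≡0 (<⇒≤ (≰⇒> y≰F))) (≢-sym (<⇒≢ (proj₁ (proj₂ (small⁻ {F} S (F ∸ y) e)))))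

module _ {F S} (ns : IsNumericalSemigroup S) (frob : IsFrobenius S F) where
  open IsNumericalSemigroup ns

  θ⁻ : y ∈ₛ θ F S → (y ∈ₛ S × small F S y ≡ false) ⊎ small F S (F ∸ y) ≡ true
  θ⁻ {y} e with ∨-true⁻ (S y ∧ not (small F S y)) (trans (sym (θ-apply F S y)) e)
  ... | inj₁ kept      = inj₁ (∧-conicalˡ _ _ kept , not-injective (∧-conicalʳ _ _ kept))
  ... | inj₂ reflected = inj₂ reflected

  θ⁺ : y ∈ₛ S → small F S y ≡ false → y ∈ₛ θ F S
  θ⁺ {y} y∈S not-small = trans (θ-apply F S y)
    (cong (_∨ small F S (F ∸ y)) (cong₂ _∧_ y∈S (cong not not-small)))

  θ-large : 0 < y → y ∈ₛ θ F S → F < 2 * y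
  θ-large {y} 0<y y∈θ with θ⁻ y∈θ
  ... | inj₂ reflected =
    reflection-small⇒large {F} {y} (proj₂ (proj₂ (small⁻ S (F ∸ y) reflected)))
  ... | inj₁ (y∈S , not-small) with <-cmp F (2 * y)
  ...   | tri< F<2y _ _ = F<2y
  ...   | tri≈ _ F≡2y _ =
    ⊥-elim (not-¬ (subst (_∈ₛ S) (sym (trans F≡2y (2*n≡n+n y))) (closed y y y∈S y∈S)) (proj₁ frob))
  ...   | tri> _ _ 2y<F = ⊥-elim (not-¬ (small⁺ S y y∈S 0<y 2y<F) not-small)

  θ-above : ∀ n → F < n → n ∈ₛ θ F S
  θ-above n F<n = θ⁺ (proj₂ frob n F<n) (small-large S n (≤-trans (<⇒≤ F<n) (m≤m+n n (n + 0))))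

  θ-Frobenius : IsFrobenius (θ F S) F
  θ-Frobenius = ¬-not F∉θ , θ-above
    where
    F∉θ : ¬ F ∈ₛ θ F S
    F∉θ F∈θ with θ⁻ F∈θ
    ... | inj₁ (F∈S , _) = not-¬ F∈S (proj₁ frob)
    ... | inj₂ small-0   = not-¬ (subst (λ z → small F S z ≡ true) (n∸n≡0 F) small-0) (small-zero F S)

  θ-closed : ∀ a b → a ∈ₛ θ F S → b ∈ₛ θ F S → (a + b) ∈ₛ θ F S
  θ-closed zero    b       _   b∈θ = b∈θ
  θ-closed (suc a) zero    a∈θ _   = subst (_∈ₛ θ F S) (sym (+-identityʳ (suc a))) a∈θ
  θ-closed (suc a) (suc b) a∈θ b∈θ =
    θ-above (suc a + suc b) (large+large {F} {suc a} {suc b} (θ-large z<s a∈θ) (θ-large z<s b∈θ))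

  θ-isNumericalSemigroup : IsNumericalSemigroup (θ F S)
  θ-isNumericalSemigroup = record
    { zero∈    = θ⁺ zero∈ (small-zero F S)
    ; closed   = θ-closed
    ; cofinite = suc F , θ-above
    }

  positive∈θ? : ∀ k → Dec (0 < k × k ∈ₛ θ F S)
  positive∈θ? k = (0 <? k) ×-dec (θ F S k Bool.≟ true)

  θ-elementary : IsElementary (θ F S)
  θ-elementary with minimal-witness positive∈θ? {suc F} (z<s , θ-above (suc F) ≤-refl)
  ... | m , (0<m , m∈θ) , below-m =
    F , θ-Frobenius ,
    m , (0<m , m∈θ , λ k 0<k k<m → ¬-not λ k∈θ → below-m k k<m (0<k , k∈θ)) ,
    θ-large 0<m m∈θ

  θ-gapsBelow : gapsBelow (θ F S) (suc F) ≡ gapsBelow S (suc F)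
  θ-gapsBelow = begin
    gapsBelow (θ F S) (suc F)                   ≡⟨ gapsBelow≡sumBelow (θ F S) (suc F) ⟩
    sumBelow (λ i → gap (θ F S i)) (suc F)      ≡⟨ sumBelow-reflection-invariant F pair ⟩
    sumBelow (λ i → gap (S i)) (suc F)          ≡⟨ gapsBelow≡sumBelow S (suc F) ⟨
    gapsBelow S (suc F)                         ∎
    where
    open ≡-Reasoning
    pair : ∀ i → i < suc F → gap (θ F S i) + gap (θ F S (F ∸ i)) ≡ gap (S i) + gap (S (F ∸ i))
    pair i i<1+F
      rewrite θ-apply F S i | θ-apply F S (F ∸ i) | m∸[m∸n]≡n (m<1+n⇒m≤n i<1+F) =
      gap-reflect-pair (S i) (S (F ∸ i)) (small F S i) (small F S (F ∸ i))
        (proj₁ ∘ small⁻ {F} S i) (proj₁ ∘ small⁻ {F} S (F ∸ i))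
        (Frobenius-split-⊥ ns frob (m<1+n⇒m≤n i<1+F))

θ-InE : InS F g S → InE F g (θ F S)
θ-InE {F} (ns , frob , genus) =
  (θ-isNumericalSemigroup ns frob , θ-Frobenius ns frob ,
   suc F , θ-above ns frob , trans (θ-gapsBelow ns frob) (genus-gapsBelow-Frobenius frob genus)) ,
  θ-elementary ns frob

elementary⇒¬small : IsFrobenius S F → IsElementary S → small F S y ≡ false
elementary⇒¬small {S} {F} {y} frob (F′ , frob′ , m , (_ , _ , S<m) , F′<2m) = ¬-not λ small-y →
  let y∈S , 0<y , 2y<F = small⁻ S y small-y in
  case y <? m of λ where
    (yes y<m) → not-¬ y∈S (S<m y 0<y y<m)
    (no  y≮m) → <-irrefl refl (<-trans 2y<F (subst (_< 2 * y) (sym (Frobenius-unique frob frob′))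
                                          (<-≤-trans F′<2m (*-monoʳ-≤ 2 (≮⇒≥ y≮m)))))

θ-fixes-elementary : IsFrobenius S F → IsElementary S → θ F S ≐ S
θ-fixes-elementary {S} {F} frob el y = begin
  θ F S y                                        ≡⟨ θ-apply F S y ⟩
  (S y ∧ not (small F S y)) ∨ small F S (F ∸ y)  ≡⟨ cong₂ (λ p q → (S y ∧ not p) ∨ q) no-small no-small ⟩
  (S y ∧ true) ∨ false                           ≡⟨ ∨-identityʳ _ ⟩
  S y ∧ true                                     ≡⟨ ∧-identityʳ _ ⟩
  S y                                            ∎
  where
  open ≡-Reasoning
  no-small : ∀ {x} → small F S x ≡ false
  no-small = elementary⇒¬small frob el

proposition6 : (F g : ℕ) → 0 < F → 0 < g → g ≤ F → F ≤ 2 * g ∸ 1 →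
    ((S : Subsetℕ) → InS F g S → InE F g (θ F S))
    × ((T : Subsetℕ) → InE F g T → ∃ λ S → InS F g S × (θ F S ≐ T))
    × ((S : Subsetℕ) → InS F g S → ((θ F S ≐ S) ⇔ InE F g S))
proposition6 F g _ _ _ _ =
  (λ S → θ-InE) ,
  (λ T (T∈S@(_ , frob , _) , el) → T , T∈S , θ-fixes-elementary frob el) ,
  λ S S∈S@(_ , frob , _) →
    mk⇔ (λ θS≐S → S∈S , IsElementary-resp-≐ θS≐S (proj₂ (θ-InE S∈S)))
        (λ (_ , el) → θ-fixes-elementary frob el)
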